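{- If $T$ is any ditree with $\delta^-(T)\ge1$ and $H$ is any digraph with $\delta^-(H)\ge 1$, then $\gamma_t(T\times H)=\gamma_t(T)\gamma_t(H)$.
   Context: All digraphs are finite, and their arc relation is irreflexive. $\delta^-(D)$ is the minimum in-degree of $D$. A ditree is a digraph whose underlying graph (the undirected graph in which $u,v$ are adjacent iff $uv$ or $vu$ is an arc) is a tree. If $\delta^-(D)\ge1$, a set $S$ is a total dominating set if every vertex of $D$ is an out-neighbor of some vertex of $S$, and $\gamma_t(D)$ is the minimum size of a total dominating set. The direct product $G\times H$ has vertex set $V(G)\times V(H)$, with an arc from $(g_1,h_1)$ to $(g_2,h_2)$ iff $g_1g_2\in A(G)$ and $h_1h_2\in A(H)$. -}

module Defs where

open import Data.Nat using (ℕ; zero; suc; _+_; _*_; _≤_)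
open import Data.Bool using (Bool; true; false; if_then_else_; _∨_; _∧_)
open import Data.Fin using (Fin; remQuot)
open import Data.Fin.Subset using (Subset; _∈_; ∣_∣)
open import Data.Nat.ListAction using (sum)
open import Data.List using (List; []; _∷_; map; length; head; last)
open import Data.List.Relation.Unary.Unique.Propositional using (Unique)
open import Data.List.Relation.Unary.Linked using (Linked)
open import Data.List using (allFin)
open import Data.Maybe using (just)
open import Data.Product using (Σ; ∃; _×_; proj₁; proj₂)
open import Relation.Binary.PropositionalEquality using (_≡_; refl)
open import Relation.Nullary using (¬_)

record Digraph : Set where
  field
    size   : ℕ
    arc    : Fin size → Fin size → Bool
    irrefl : ∀ v → arc v v ≡ false
open Digraph public

Arc : (D : Digraph) → Fin (size D) → Fin (size D) → Set
Arc D u v = arc D u v ≡ true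

inDeg : (D : Digraph) → Fin (size D) → ℕ
inDeg D v = sum (map (λ u → if arc D u v then 1 else 0) (allFin (size D)))

MinInDegGe1 : Digraph → Set
MinInDegGe1 D = ∀ v → 1 ≤ inDeg D v

UAdj : (D : Digraph) → Fin (size D) → Fin (size D) → Set
UAdj D u v = (arc D u v ∨ arc D v u) ≡ true

WalkU : (D : Digraph) → Fin (size D) → Fin (size D) → List (Fin (size D)) → Set
WalkU D u v ws = (head ws ≡ just u) × (last ws ≡ just v) × Linked (UAdj D) ws

ConnectedU : Digraph → Set
ConnectedU D = ∀ u v → ∃ λ ws → WalkU D u v ws

CycleU : (D : Digraph) → List (Fin (size D)) → Set
CycleU D ws = (3 ≤ length ws) × Unique ws × Linked (UAdj D) ws
            × (∃ λ a → ∃ λ b → head ws ≡ just a × last ws ≡ just b × UAdj D b a)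

AcyclicU : Digraph → Set
AcyclicU D = ∀ ws → ¬ CycleU D ws

IsDitree : Digraph → Set
IsDitree D = (1 ≤ size D) × ConnectedU D × AcyclicU D

IsTDS : (D : Digraph) → Subset (size D) → Set
IsTDS D S = ∀ v → ∃ λ u → u ∈ S × Arc D u v

IsGammaT : (D : Digraph) → ℕ → Set
IsGammaT D k = (∃ λ S → IsTDS D S × ∣ S ∣ ≡ k) × (∀ S → IsTDS D S → k ≤ ∣ S ∣)

_×ᴰ_ : Digraph → Digraph → Digraph
G ×ᴰ H = record
  { size   = size G * size H
  ; arc    = λ x y → arc G (proj₁ (pr x)) (proj₁ (pr y))
                   ∧ arc H (proj₂ (pr x)) (proj₂ (pr y))
  ; irrefl = λ x → irr (proj₁ (pr x)) (proj₂ (pr x))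
  }
  where
  pr : Fin (size G * size H) → Fin (size G) × Fin (size H)
  pr = remQuot {size G} (size H)
  irr : ∀ g h → (arc G g g ∧ arc H h h) ≡ false
  irr g h rewrite irrefl G g = refl

-- Upper bound: if S and R are total dominating sets of T and H, then S × R is
-- one of T × H.
--
-- Lower bound: let P be an open packing of T (no two vertices of P have a
-- common in-neighbour) and D a total dominating set of T × H. For p ∈ P the
-- second coordinates of the vertices (g, h) ∈ D with g → p form a total
-- dominating set of H, so there are at least γₜ(H) such vertices; as each g has
-- at most one out-neighbour in P, these parts of D are disjoint, and
-- ∣D∣ ≥ ∣P∣ γₜ(H). It thus suffices that a ditree T with δ⁻(T) ≥ 1 has an open
-- packing P with γₜ(T) ≤ ∣P∣. Root the underlying tree and build P and a total
-- dominating set S greedily: take a deepest vertex v not yet dominated, put v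
-- into P and an in-neighbour x of v into S, choosing for x the parent of v if
-- it is an in-neighbour. Every undominated vertex sharing an in-neighbour with
-- v is then an out-neighbour of x, so it becomes dominated and P remains an
-- open packing.
module Submission where

open import Defs
open import Data.Bool using (Bool; true; false; _∧_; _∨_; if_then_else_)
import Data.Bool as Bool
open import Data.Bool.Properties using (∨-comm)
open import Data.Empty using (⊥; ⊥-elim)
open import Data.Fin using (Fin; zero; suc; fromℕ<; _↑ˡ_; _↑ʳ_; combine; remQuot)
open import Data.Fin.Properties using (_≟_; remQuot-combine; combine-remQuot; any?)
open import Data.Fin.Subset
  using (Subset; _∈_; _∉_; _∩_; _∪_; _─_; ∣_∣; ⁅_⁆; ⊤; inside; outside) renaming (⊥ to ∅)
open import Data.Fin.Subset.Properties
  using ( _∈?_; nonempty?; ∈⊤; ∉⊥; x∈⁅x⁆; x∈⁅y⁆⇒x≡y; p⊆p∪q; q⊆p∪q; x∈p∪q⁻; x∈p∩q⁺; x∈p∩q⁻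
        ; p─q⊆p; x∈p∧x∉q⇒x∈p─q; ∣p∣≤n; ∣p∣≤∣x∷p∣; ∣⊥∣≡0; ∣⁅x⁆∣≡1; p⊆q⇒∣p∣≤∣q∣
        ; p⊂q⇒∣p∣<∣q∣; p∩q≢∅⇒∣p─q∣<∣p∣)
import Data.List as List
open import Data.List using (List; []; _∷_; _∷ʳ_; head; last; length; filter; allFin)
open import Data.List.Extrema.Nat using (argmax; argmax-sel; f[xs]≤f[argmax])
open import Data.List.Membership.Propositional.Properties using (∈-filter⁺; ∈-filter⁻; ∈-allFin)
open import Data.List.Properties using (length-++)
open import Data.List.Relation.Unary.All using (All; []; _∷_)
import Data.List.Relation.Unary.All as All
open import Data.List.Relation.Unary.All.Properties using (∷ʳ⁺)
open import Data.List.Relation.Unary.AllPairs using ([]; _∷_)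
open import Data.List.Relation.Unary.Linked using (Linked; []; [-]; _∷_)
open import Data.List.Relation.Unary.Unique.Propositional using (Unique)
open import Data.Maybe using (just)
open import Data.Nat using (ℕ; zero; suc; _+_; _*_; _≤_; _<_; z≤n; s≤s; s≤s⁻¹)
import Data.Nat.ListAction as ListAction
open import Data.Nat.Properties
  using ( +-*-semiring; module ≤-Reasoning; _<?_; <-cmp; ≤-refl; ≤-reflexive; ≤-trans; ≤-antisym
        ; <-irrefl; <-trans; <-≤-trans; ≮⇒≥; 1+n≰n; m≤n⇒m≤1+n; m≤m+n; suc-injective
        ; +-assoc; +-comm; +-suc; +-identityʳ; +-mono-≤; +-monoˡ-≤; +-monoʳ-≤
        ; *-assoc; *-identityˡ; *-monoˡ-≤; *-monoʳ-≤)
open import Algebra.Properties.Semiring.Sum +-*-semiring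
  using (sum; sum-cong-≗; sum-remove; ∑-comm; *-distribˡ-sum; *-distribʳ-sum)
open import Data.Product using (∃; ∃₂; _×_; _,_; proj₁; proj₂; uncurry)
open import Data.Sum using (_⊎_; inj₁; inj₂)
import Data.Sum as Sum
open import Data.Vec using ([]; _∷_; here; there; lookup; tabulate)
open import Data.Vec.Properties using (lookup∘tabulate; lookup-zipWith; []=⇒lookup; lookup⇒[]=)
open import Function using (_∘_; case_of_)
open import Relation.Binary.Definitions using (tri<; tri≈; tri>)
open import Relation.Binary.PropositionalEquality
  using (_≡_; _≢_; refl; sym; trans; cong; cong₂; subst; module ≡-Reasoning)
open import Relation.Nullary using (¬_; yes; no; does; contradiction)
open import Relation.Nullary.Decidable using (dec-true; _×-dec_)
open import Relation.Unary using (Pred; Decidable)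

private
  variable
    m n : ℕ

sum-mono-≤ : {f g : Fin n → ℕ} → (∀ i → f i ≤ g i) → sum f ≤ sum g
sum-mono-≤ {zero}  f≤g = z≤n
sum-mono-≤ {suc n} f≤g = +-mono-≤ (f≤g zero) (sum-mono-≤ (f≤g ∘ suc))

term≤sum : (f : Fin n → ℕ) (i : Fin n) → f i ≤ sum f
term≤sum {suc n} f i = ≤-trans (m≤m+n (f i) _) (≤-reflexive (sym (sum-remove {i = i} f)))

sum-↑ : ∀ k {l} (f : Fin (k + l) → ℕ) → sum f ≡ sum (f ∘ (_↑ˡ l)) + sum (f ∘ (k ↑ʳ_))
sum-↑ zero    f = refl
sum-↑ (suc k) f = trans (cong (f zero +_) (sum-↑ k (f ∘ suc))) (sym (+-assoc (f zero) _ _))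

sum-combine : (f : Fin (m * n) → ℕ) → sum f ≡ sum λ (g : Fin m) → sum λ (h : Fin n) → f (combine g h)
sum-combine {zero}      f = refl
sum-combine {suc m} {n} f =
  trans (sum-↑ n {m * n} f)
        (cong (sum (λ (h : Fin n) → f (combine {suc m} zero h)) +_) (sum-combine {m} {n} (f ∘ (n ↑ʳ_))))

χ : Subset n → Fin n → ℕ
χ p i = if lookup p i then 1 else 0

∣p∣≡∑χ : (p : Subset n) → ∣ p ∣ ≡ sum (χ p)
∣p∣≡∑χ []            = refl
∣p∣≡∑χ (inside  ∷ p) = cong suc (∣p∣≡∑χ p)
∣p∣≡∑χ (outside ∷ p) = ∣p∣≡∑χ p

χ-∈ : {p : Subset n} {i : Fin n} → i ∈ p → χ p i ≡ 1
χ-∈ i∈p rewrite []=⇒lookup i∈p = refl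

χ-∉ : {p : Subset n} {i : Fin n} → i ∉ p → χ p i ≡ 0
χ-∉ {p = p} {i} i∉p with lookup p i in eq
... | true  = contradiction (lookup⇒[]= i p eq) i∉p
... | false = refl

χ-∩ : (p q : Subset n) (i : Fin n) → χ (p ∩ q) i ≡ χ p i * χ q i
χ-∩ p q i rewrite lookup-zipWith _∧_ i p q with lookup p i
... | true  = sym (+-identityʳ _)
... | false = refl

χ-tabulate : (f : Fin n → Bool) (i : Fin n) → χ (tabulate f) i ≡ (if f i then 1 else 0)
χ-tabulate f i = cong (λ b → if b then 1 else 0) (lookup∘tabulate f i)

χ*-monoʳ : ∀ {a b} (p : Subset n) (i : Fin n) → (i ∈ p → a ≤ b) → χ p i * a ≤ χ p i * b
χ*-monoʳ p i a≤b with i ∈? p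
... | yes i∈p = *-monoʳ-≤ (χ p i) (a≤b i∈p)
... | no  i∉p rewrite χ-∉ i∉p = z≤n

∈-tabulate⁺ : {f : Fin n → Bool} {i : Fin n} → f i ≡ true → i ∈ tabulate f
∈-tabulate⁺ {f = f} {i} fi = lookup⇒[]= i (tabulate f) (trans (lookup∘tabulate f i) fi)

∈-tabulate⁻ : {f : Fin n → Bool} {i : Fin n} → i ∈ tabulate f → f i ≡ true
∈-tabulate⁻ {f = f} {i} i∈ = trans (sym (lookup∘tabulate f i)) ([]=⇒lookup i∈)

x∈p─q⇒x∉q : (p q : Subset n) {x : Fin n} → x ∈ p ─ q → x ∉ q
x∈p─q⇒x∉q (_ ∷ p) (outside ∷ q) here       ()
x∈p─q⇒x∉q (_ ∷ p) (_       ∷ q) (there x∈) (there x∈q) = x∈p─q⇒x∉q p q x∈ x∈q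

∣p∪q∣≤∣p∣+∣q∣ : (p q : Subset n) → ∣ p ∪ q ∣ ≤ ∣ p ∣ + ∣ q ∣
∣p∪q∣≤∣p∣+∣q∣ []            []            = z≤n
∣p∪q∣≤∣p∣+∣q∣ (inside  ∷ p) (s       ∷ q) =
  s≤s (≤-trans (∣p∪q∣≤∣p∣+∣q∣ p q) (+-monoʳ-≤ ∣ p ∣ (∣p∣≤∣x∷p∣ s q)))
∣p∪q∣≤∣p∣+∣q∣ (outside ∷ p) (inside  ∷ q) =
  ≤-trans (s≤s (∣p∪q∣≤∣p∣+∣q∣ p q)) (≤-reflexive (sym (+-suc ∣ p ∣ ∣ q ∣)))
∣p∪q∣≤∣p∣+∣q∣ (outside ∷ p) (outside ∷ q) = ∣p∪q∣≤∣p∣+∣q∣ p q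

∣p∣≤1 : {p : Subset n} → (∀ {x y} → x ∈ p → y ∈ p → x ≡ y) → ∣ p ∣ ≤ 1
∣p∣≤1 {n} {p} unique with nonempty? p
... | yes (x , x∈p) = ≤-trans (p⊆q⇒∣p∣≤∣q∣ λ y∈p → subst (_∈ ⁅ x ⁆) (unique x∈p y∈p) (x∈⁅x⁆ x))
                              (≤-reflexive (∣⁅x⁆∣≡1 x))
... | no  empty     = ≤-trans (p⊆q⇒∣p∣≤∣q∣ {q = ∅} λ {y} y∈p → contradiction (y , y∈p) empty)
                              (≤-trans (≤-reflexive (∣⊥∣≡0 n)) z≤n)

argmax-∈ : (f : Fin n → ℕ) {p : Subset n} {v : Fin n} → v ∈ p →
           ∃ λ w → w ∈ p × ∀ {x} → x ∈ p → f x ≤ f w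
argmax-∈ {n} f {p} {v} v∈p =
  w , w∈p , λ {x} x∈p → All.lookup (f[xs]≤f[argmax] v xs) (∈-filter⁺ (_∈? p) (∈-allFin x) x∈p)
  where
  xs = filter (_∈? p) (allFin n)
  w  = argmax f v xs
  w∈p : w ∈ p
  w∈p = Sum.[ (λ w≡v → subst (_∈ p) (sym w≡v) v∈p)
            , (λ w∈xs → proj₂ (∈-filter⁻ (_∈? p) {xs = allFin n} w∈xs)) ]′ (argmax-sel f v xs)

module _ {ℓ} {P : Pred (Fin n) ℓ} (P? : Decidable P) where

  select : Subset n
  select = tabulate (does ∘ P?)

  ∈-select⁺ : ∀ {i} → P i → i ∈ select
  ∈-select⁺ Pi = ∈-tabulate⁺ (dec-true (P? _) Pi)

  ∈-select⁻ : ∀ {i} → i ∈ select → P i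
  ∈-select⁻ {i} i∈ with P? i | ∈-tabulate⁻ {f = does ∘ P?} i∈
  ... | yes Pi | _  = Pi
  ... | no  _  | ()

covered? : (I : Subset m) (A : Fin m → Subset n) → Decidable λ h → ∃ λ g → g ∈ I × h ∈ A g
covered? I A h = any? λ g → g ∈? I ×-dec h ∈? A g

⋃[_]_ : Subset m → (Fin m → Subset n) → Subset n
⋃[ I ] A = select (covered? I A)

∈-⋃⁺ : {I : Subset m} {A : Fin m → Subset n} {g : Fin m} {h : Fin n} →
       g ∈ I → h ∈ A g → h ∈ ⋃[ I ] A
∈-⋃⁺ {I = I} {A} {g} g∈I h∈Ag = ∈-select⁺ (covered? I A) (g , g∈I , h∈Ag)

∣⋃∣≤∑ : (I : Subset m) (A : Fin m → Subset n) → ∣ ⋃[ I ] A ∣ ≤ sum λ g → χ I g * ∣ A g ∣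
∣⋃∣≤∑ I A = begin
  ∣ ⋃[ I ] A ∣                               ≡⟨ ∣p∣≡∑χ (⋃[ I ] A) ⟩
  sum (χ (⋃[ I ] A))                         ≤⟨ sum-mono-≤ covered ⟩
  sum (λ h → sum λ g → χ I g * χ (A g) h)    ≡⟨ ∑-comm (λ h g → χ I g * χ (A g) h) ⟩
  sum (λ g → sum λ h → χ I g * χ (A g) h)    ≡⟨ sum-cong-≗ (λ g → sym (*-distribˡ-sum (χ I g) (χ (A g)))) ⟩
  sum (λ g → χ I g * sum (χ (A g)))          ≡⟨ sum-cong-≗ (λ g → cong (χ I g *_) (sym (∣p∣≡∑χ (A g)))) ⟩
  sum (λ g → χ I g * ∣ A g ∣)                ∎
  where
  open ≤-Reasoning
  covered : ∀ h → χ (⋃[ I ] A) h ≤ sum λ g → χ I g * χ (A g) h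
  covered h with h ∈? ⋃[ I ] A
  ... | no  h∉ = ≤-trans (≤-reflexive (χ-∉ h∉)) z≤n
  ... | yes h∈ with ∈-select⁻ (covered? I A) h∈
  ... | g , g∈I , h∈Ag = begin
    χ (⋃[ I ] A) h                 ≡⟨ χ-∈ h∈ ⟩
    1                              ≡⟨ sym (cong₂ _*_ (χ-∈ g∈I) (χ-∈ h∈Ag)) ⟩
    χ I g * χ (A g) h              ≤⟨ term≤sum (λ g → χ I g * χ (A g) h) g ⟩
    sum (λ g → χ I g * χ (A g) h)  ∎

∑∑χ≤∑ : (N : Fin m → Subset n) (c : Fin m → ℕ) → (∀ g → ∣ N g ∣ ≤ 1) →
        sum (λ p → sum λ g → χ (N g) p * c g) ≤ sum c
∑∑χ≤∑ N c ∣N∣≤1 = begin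
  sum (λ p → sum λ g → χ (N g) p * c g)  ≡⟨ ∑-comm (λ p g → χ (N g) p * c g) ⟩
  sum (λ g → sum λ p → χ (N g) p * c g)  ≡⟨ sum-cong-≗ (λ g → sym (*-distribʳ-sum (c g) (χ (N g)))) ⟩
  sum (λ g → sum (χ (N g)) * c g)        ≡⟨ sum-cong-≗ (λ g → cong (_* c g) (sym (∣p∣≡∑χ (N g)))) ⟩
  sum (λ g → ∣ N g ∣ * c g)              ≤⟨ sum-mono-≤ (λ g → *-monoˡ-≤ (c g) (∣N∣≤1 g)) ⟩
  sum (λ g → 1 * c g)                    ≡⟨ sum-cong-≗ (λ g → *-identityˡ (c g)) ⟩
  sum c                                  ∎
  where open ≤-Reasoning

_⊠_ : Subset m → Subset n → Subset (m * n)
_⊠_ {n = n} S R = tabulate (uncurry (λ g h → lookup S g ∧ lookup R h) ∘ remQuot n)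

lookup-⊠ : (S : Subset m) (R : Subset n) (g : Fin m) (h : Fin n) →
           lookup (S ⊠ R) (combine g h) ≡ lookup S g ∧ lookup R h
lookup-⊠ S R g h =
  trans (lookup∘tabulate _ (combine g h))
        (cong (uncurry λ g h → lookup S g ∧ lookup R h) (remQuot-combine g h))

∈-⊠⁺ : {S : Subset m} {R : Subset n} {g : Fin m} {h : Fin n} → g ∈ S → h ∈ R → combine g h ∈ S ⊠ R
∈-⊠⁺ {S = S} {R} {g} {h} g∈S h∈R =
  lookup⇒[]= (combine g h) (S ⊠ R)
    (trans (lookup-⊠ S R g h) (cong₂ _∧_ ([]=⇒lookup g∈S) ([]=⇒lookup h∈R)))

∣⊠∣ : (S : Subset m) (R : Subset n) → ∣ S ⊠ R ∣ ≡ ∣ S ∣ * ∣ R ∣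
∣⊠∣ {m} {n} S R = begin
  ∣ S ⊠ R ∣                                               ≡⟨ ∣p∣≡∑χ (S ⊠ R) ⟩
  sum (χ (S ⊠ R))                                         ≡⟨ sum-combine {m} {n} (χ (S ⊠ R)) ⟩
  sum (λ g → sum λ h → χ (S ⊠ R) (combine {m} {n} g h))  ≡⟨ sum-cong-≗ (λ g → sum-cong-≗ (χ-⊠ g)) ⟩
  sum (λ g → sum λ h → χ S g * χ R h)                     ≡⟨ sum-cong-≗ (λ g → sym (*-distribˡ-sum (χ S g) (χ R))) ⟩
  sum (λ g → χ S g * sum (χ R))                           ≡⟨ sym (*-distribʳ-sum (sum (χ R)) (χ S)) ⟩
  sum (χ S) * sum (χ R)                                   ≡⟨ sym (cong₂ _*_ (∣p∣≡∑χ S) (∣p∣≡∑χ R)) ⟩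
  ∣ S ∣ * ∣ R ∣                                           ∎
  where
  open ≡-Reasoning
  χ-⊠ : ∀ g h → χ (S ⊠ R) (combine g h) ≡ χ S g * χ R h
  χ-⊠ g h rewrite lookup-⊠ S R g h with lookup S g
  ... | true  = sym (+-identityʳ _)
  ... | false = refl

fibre : Subset (m * n) → Fin m → Subset n
fibre D g = tabulate λ h → lookup D (combine g h)

∈-fibre⁺ : {D : Subset (m * n)} {g : Fin m} {h : Fin n} → combine g h ∈ D → h ∈ fibre D g
∈-fibre⁺ x∈D = ∈-tabulate⁺ ([]=⇒lookup x∈D)

∣D∣≡∑∣fibre∣ : (D : Subset (m * n)) → ∣ D ∣ ≡ sum λ g → ∣ fibre {m} {n} D g ∣
∣D∣≡∑∣fibre∣ {m} {n} D = begin
  ∣ D ∣                                            ≡⟨ ∣p∣≡∑χ D ⟩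
  sum (χ D)                                        ≡⟨ sum-combine {m} {n} (χ D) ⟩
  sum (λ g → sum λ h → χ D (combine {m} {n} g h))  ≡⟨ sum-cong-≗ (λ g → sym (sum-cong-≗
                                                        (χ-tabulate (lookup D ∘ combine {m} {n} g)))) ⟩
  sum (λ g → sum (χ (fibre {m} {n} D g)))          ≡⟨ sum-cong-≗ (λ g → sym (∣p∣≡∑χ (fibre {m} {n} D g))) ⟩
  sum (λ g → ∣ fibre {m} {n} D g ∣)                ∎
  where open ≡-Reasoning

least-witness : ∀ {ℓ} {P : Pred ℕ ℓ} → Decidable P → ∀ {k} → P k →
                ∃ λ n → P n × (∀ {j} → j < n → ¬ P j)
least-witness P? {zero}  Pk = zero , Pk , λ ()
least-witness P? {suc k} Pk with P? zero
... | yes P0 = zero , P0 , λ ()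
... | no ¬P0 with least-witness (P? ∘ suc) Pk
... | n , Pn , below = suc n , Pn , λ { {zero} _ → ¬P0 ; {suc j} j<n → below (s≤s⁻¹ j<n) }

∧-≡-true⁻ : ∀ {a b} → a ∧ b ≡ true → a ≡ true × b ≡ true
∧-≡-true⁻ {true} {true} _ = refl , refl

in-neighbour : (D : Digraph) → MinInDegGe1 D → ∀ v → ∃ λ u → Arc D u v
in-neighbour D δ⁻≥1 v = witness (allFin (size D)) (δ⁻≥1 v)
  where
  witness : ∀ us → 1 ≤ ListAction.sum (List.map (λ u → if arc D u v then 1 else 0) us) →
            ∃ λ u → Arc D u v
  witness (u ∷ us) pos with arc D u v in u→v
  ... | true  = u , u→v
  ... | false = witness us pos

arc⇒UAdj : (D : Digraph) {u v : Fin (size D)} → Arc D u v → UAdj D u v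
arc⇒UAdj D u→v rewrite u→v = refl

UAdj-sym : (D : Digraph) {u v : Fin (size D)} → UAdj D u v → UAdj D v u
UAdj-sym D {u} {v} u~v = trans (∨-comm (arc D v u) (arc D u v)) u~v

¬UAdj-refl : (D : Digraph) {u : Fin (size D)} → ¬ UAdj D u u
¬UAdj-refl D {u} u~u rewrite irrefl D u = case u~u of λ ()

inNbrs outNbrs uNbrs : (D : Digraph) → Fin (size D) → Subset (size D)
inNbrs  D v = tabulate λ u → arc D u v
outNbrs D u = tabulate (arc D u)
uNbrs   D u = tabulate λ v → arc D u v ∨ arc D v u

OpenPacking : (D : Digraph) → Subset (size D) → Set
OpenPacking D P = ∀ {p q c} → p ∈ P → q ∈ P → Arc D c p → Arc D c q → p ≡ q

∣P∩outNbrs∣≤1 : (D : Digraph) {P : Subset (size D)} → OpenPacking D P → ∀ c → ∣ P ∩ outNbrs D c ∣ ≤ 1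
∣P∩outNbrs∣≤1 D {P} packing c = ∣p∣≤1 λ p∈ q∈ →
  let p∈P , c→p = x∈p∩q⁻ P (outNbrs D c) p∈
      q∈P , c→q = x∈p∩q⁻ P (outNbrs D c) q∈
  in packing p∈P q∈P (∈-tabulate⁻ c→p) (∈-tabulate⁻ c→q)

module _ (G H : Digraph) where

  ×ᴰ-vertex : (x : Fin (size (G ×ᴰ H))) → ∃₂ λ (g : Fin (size G)) (h : Fin (size H)) → x ≡ combine g h
  ×ᴰ-vertex x = proj₁ (remQuot {size G} (size H) x) , proj₂ (remQuot {size G} (size H) x) ,
                sym (combine-remQuot {size G} (size H) x)

  arc-combine : ∀ g h g′ h′ → arc (G ×ᴰ H) (combine g h) (combine g′ h′) ≡ arc G g g′ ∧ arc H h h′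
  arc-combine g h g′ h′ =
    cong₂ (λ x y → arc G (proj₁ x) (proj₁ y) ∧ arc H (proj₂ x) (proj₂ y))
          (remQuot-combine g h) (remQuot-combine g′ h′)

  ×ᴰ-arc⁺ : ∀ {g h g′ h′} → Arc G g g′ → Arc H h h′ → Arc (G ×ᴰ H) (combine g h) (combine g′ h′)
  ×ᴰ-arc⁺ {g} {h} {g′} {h′} g→g′ h→h′ = trans (arc-combine g h g′ h′) (cong₂ _∧_ g→g′ h→h′)

  ×ᴰ-arc⁻ : ∀ {g h g′ h′} → Arc (G ×ᴰ H) (combine g h) (combine g′ h′) → Arc G g g′ × Arc H h h′
  ×ᴰ-arc⁻ {g} {h} {g′} {h′} x→y = ∧-≡-true⁻ (trans (sym (arc-combine g h g′ h′)) x→y)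

  IsTDS-⊠ : ∀ {S R} → IsTDS G S → IsTDS H R → IsTDS (G ×ᴰ H) (S ⊠ R)
  IsTDS-⊠ S-tds R-tds y with ×ᴰ-vertex y
  ... | g , h , refl with S-tds g | R-tds h
  ... | s , s∈S , s→g | r , r∈R , r→h = combine s r , ∈-⊠⁺ s∈S r∈R , ×ᴰ-arc⁺ s→g r→h

  shadow : Subset (size (G ×ᴰ H)) → Fin (size G) → Subset (size H)
  shadow D p = ⋃[ inNbrs G p ] fibre D

  shadow-isTDS : ∀ {D} → IsTDS (G ×ᴰ H) D → ∀ p → IsTDS H (shadow D p)
  shadow-isTDS {D} D-tds p h′ with D-tds (combine p h′)
  ... | x , x∈D , x→ph′ with ×ᴰ-vertex x
  ... | g , h , refl with ×ᴰ-arc⁻ x→ph′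
  ... | g→p , h→h′ =
    h , ∈-⋃⁺ {I = inNbrs G p} {A = fibre D} (∈-tabulate⁺ g→p) (∈-fibre⁺ {size G} x∈D) , h→h′

  packing-bound : ∀ {P D b} → OpenPacking G P → (∀ R → IsTDS H R → b ≤ ∣ R ∣) →
                  IsTDS (G ×ᴰ H) D → ∣ P ∣ * b ≤ ∣ D ∣
  packing-bound {P} {D} {b} packing γₜH≥b D-tds = begin
    ∣ P ∣ * b                                               ≡⟨ cong (_* b) (∣p∣≡∑χ P) ⟩
    sum (χ P) * b                                           ≡⟨ *-distribʳ-sum b (χ P) ⟩
    sum (λ p → χ P p * b)                                   ≤⟨ sum-mono-≤ (λ p → χ*-monoʳ P p λ _ →
                                                                 γₜH≥b _ (shadow-isTDS D-tds p)) ⟩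
    sum (λ p → χ P p * ∣ shadow D p ∣)                      ≤⟨ sum-mono-≤ (λ p → χ*-monoʳ P p λ _ →
                                                                 ∣⋃∣≤∑ (inNbrs G p) (fibre D)) ⟩
    sum (λ p → χ P p * sum λ g → χ (inNbrs G p) g * c g)    ≡⟨ sum-cong-≗ (λ p → *-distribˡ-sum (χ P p)
                                                                 λ g → χ (inNbrs G p) g * c g) ⟩
    sum (λ p → sum λ g → χ P p * (χ (inNbrs G p) g * c g))  ≡⟨ sum-cong-≗ (λ p → sum-cong-≗ (incidence p)) ⟩
    sum (λ p → sum λ g → χ (P ∩ outNbrs G g) p * c g)       ≤⟨ ∑∑χ≤∑ (λ g → P ∩ outNbrs G g) c
                                                                 (∣P∩outNbrs∣≤1 G packing) ⟩
    sum c                                                   ≡⟨ sym (∣D∣≡∑∣fibre∣ {size G} D) ⟩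
    ∣ D ∣                                                   ∎
    where
    open ≤-Reasoning
    c : Fin (size G) → ℕ
    c g = ∣ fibre D g ∣
    incidence : ∀ p g → χ P p * (χ (inNbrs G p) g * c g) ≡ χ (P ∩ outNbrs G g) p * c g
    incidence p g = begin-equality
      χ P p * (χ (inNbrs G p) g * c g)  ≡⟨ sym (*-assoc (χ P p) _ (c g)) ⟩
      χ P p * χ (inNbrs G p) g * c g    ≡⟨ cong (λ k → χ P p * k * c g)
                                            (trans (χ-tabulate _ g) (sym (χ-tabulate _ p))) ⟩
      χ P p * χ (outNbrs G g) p * c g   ≡⟨ cong (_* c g) (sym (χ-∩ P (outNbrs G g) p)) ⟩
      χ (P ∩ outNbrs G g) p * c g       ∎

data Path (D : Digraph) : Fin (size D) → Fin (size D) → List (Fin (size D)) → Set where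
  [_] : ∀ u → Path D u u (u ∷ [])
  _◅_ : ∀ {u v w xs} → UAdj D u v → Path D v w xs → Path D u w (u ∷ xs)

module _ {D : Digraph} where

  Path-∷ʳ : ∀ {u v w xs} → Path D u v xs → UAdj D v w → Path D u w (xs ∷ʳ w)
  Path-∷ʳ [ u ]        v~w = v~w ◅ [ _ ]
  Path-∷ʳ (u~x ◅ path) v~w = u~x ◅ Path-∷ʳ path v~w

  Path-head : ∀ {u w xs} → Path D u w xs → head xs ≡ just u
  Path-head [ u ]   = refl
  Path-head (_ ◅ _) = refl

  Path-last : ∀ {u w xs} → Path D u w xs → last xs ≡ just w
  Path-last [ u ]              = refl
  Path-last (_ ◅ [ v ])        = refl
  Path-last (_ ◅ path@(_ ◅ _)) = Path-last path

  Path-linked : ∀ {u w xs} → Path D u w xs → Linked (UAdj D) xs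
  Path-linked [ u ]                = [-]
  Path-linked (u~v ◅ [ v ])        = u~v ∷ [-]
  Path-linked (u~v ◅ path@(_ ◅ _)) = u~v ∷ Path-linked path

  Path-nonempty : ∀ {u w xs} → Path D u w xs → 1 ≤ length xs
  Path-nonempty [ u ]   = s≤s z≤n
  Path-nonempty (_ ◅ _) = s≤s z≤n

  closed-path⇒cycle : ∀ {u w xs} → Path D u w xs → Unique xs → 3 ≤ length xs → UAdj D w u → CycleU D xs
  closed-path⇒cycle {u} {w} path unique long w~u =
    long , unique , Path-linked path , u , w , Path-head path , Path-last path , w~u

Unique-∷ʳ : ∀ {a} {A : Set a} {xs : List A} {y : A} → Unique xs → All (_≢ y) xs → Unique (xs ∷ʳ y)
Unique-∷ʳ []              []           = [] ∷ []
Unique-∷ʳ (x∉xs ∷ unique) (x≢y ∷ xs≢y) = ∷ʳ⁺ x∉xs x≢y ∷ Unique-∷ʳ unique xs≢y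

module Depth (D : Digraph) (r : Fin (size D)) (connected : ConnectedU D) where

  ball : ℕ → Subset (size D)
  ball zero    = ⁅ r ⁆
  ball (suc k) = ball k ∪ ⋃[ ball k ] uNbrs D

  ball-step : ∀ {k u v} → u ∈ ball k → UAdj D u v → v ∈ ball (suc k)
  ball-step {k} u∈ u~v = q⊆p∪q (ball k) _ (∈-⋃⁺ {I = ball k} {A = uNbrs D} u∈ (∈-tabulate⁺ u~v))

  walk-reaches : ∀ {k u v} xs → u ∈ ball k → Linked (UAdj D) (u ∷ xs) → last (u ∷ xs) ≡ just v →
                 ∃ λ j → v ∈ ball j
  walk-reaches {k} []       u∈ _            refl = k , u∈
  walk-reaches {k} (x ∷ xs) u∈ (u~x ∷ walk) end  = walk-reaches {suc k} xs (ball-step {k} u∈ u~x) walk end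

  reachable : ∀ v → ∃ λ k → v ∈ ball k
  reachable v with connected r v
  ... | r ∷ xs , refl , end , walk = walk-reaches {0} xs (x∈⁅x⁆ r) walk end

  least-ball : ∀ v → ∃ λ n → v ∈ ball n × (∀ {j} → j < n → v ∉ ball j)
  least-ball v = least-witness (λ k → v ∈? ball k) {proj₁ (reachable v)} (proj₂ (reachable v))

  depth : Fin (size D) → ℕ
  depth v = proj₁ (least-ball v)

  ∈-ball-depth : ∀ v → v ∈ ball (depth v)
  ∈-ball-depth v = proj₁ (proj₂ (least-ball v))

  ∉-ball-<depth : ∀ {v k} → k < depth v → v ∉ ball k
  ∉-ball-<depth {v} = proj₂ (proj₂ (least-ball v))

  depth-≤ : ∀ {v k} → v ∈ ball k → depth v ≤ k
  depth-≤ v∈ = ≮⇒≥ λ k<d → ∉-ball-<depth k<d v∈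

  depth≡0⇒root : ∀ {v} → depth v ≡ 0 → v ≡ r
  depth≡0⇒root {v} d≡0 = x∈⁅y⁆⇒x≡y r (subst (λ k → v ∈ ball k) d≡0 (∈-ball-depth v))

  depth-adj : ∀ {u v} → UAdj D u v → depth v ≤ suc (depth u)
  depth-adj {u} u~v = depth-≤ (ball-step {depth u} (∈-ball-depth u) u~v)

  depth-lower-adj : ∀ {u v} → UAdj D u v → depth u < depth v → depth v ≡ suc (depth u)
  depth-lower-adj u~v u<v = ≤-antisym (depth-adj u~v) u<v

  parent : ∀ {v k} → depth v ≡ suc k → ∃ λ u → UAdj D u v × depth u ≡ k
  parent {v} {k} d≡ with x∈p∪q⁻ (ball k) _ (subst (λ j → v ∈ ball j) d≡ (∈-ball-depth v))
  ... | inj₁ v∈ = contradiction v∈ (∉-ball-<depth (≤-reflexive (sym d≡)))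
  ... | inj₂ v∈ with ∈-select⁻ (covered? (ball k) (uNbrs D)) v∈
  ... | u , u∈ , v∈uNbrs = u , u~v , ≤-antisym (depth-≤ u∈) (s≤s⁻¹ (subst (_≤ suc (depth u)) d≡ (depth-adj u~v)))
    where
    u~v : UAdj D u v
    u~v = ∈-tabulate⁻ v∈uNbrs

  deeper-∉ : ∀ {k y xs} → All (λ x → depth x ≤ k) xs → depth y ≡ suc k → All (y ≢_) xs
  deeper-∉ {k} shallow dy = All.map (λ { dx≤k refl → 1+n≰n (subst (_≤ k) dy dx≤k) }) shallow

  mutual
    path-below : ∀ k {u w} → depth u ≡ k → depth w ≡ k →
                 ∃ λ xs → Path D u w xs × Unique xs × All (λ x → depth x ≤ k) xs
    path-below k {u} {w} du dw with u ≟ w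
    ... | yes refl = u ∷ [] , [ u ] , [] ∷ [] , ≤-reflexive du ∷ []
    ... | no  u≢w  with long-path-below k du dw u≢w
    ... | xs , path , unique , shallow , _ = xs , path , unique , shallow

    long-path-below : ∀ k {u w} → depth u ≡ k → depth w ≡ k → u ≢ w →
                      ∃ λ xs → Path D u w xs × Unique xs × All (λ x → depth x ≤ k) xs × 3 ≤ length xs
    long-path-below zero du dw u≢w = contradiction (trans (depth≡0⇒root du) (sym (depth≡0⇒root dw))) u≢w
    long-path-below (suc k) {u} {w} du dw u≢w with parent du | parent dw
    ... | pu , pu~u , dpu | pw , pw~w , dpw with path-below k dpu dpw
    ... | xs , path , unique , shallow =
      u ∷ xs ∷ʳ w ,
      UAdj-sym D pu~u ◅ Path-∷ʳ path pw~w ,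
      ∷ʳ⁺ (deeper-∉ shallow du) u≢w ∷ Unique-∷ʳ unique (All.map (λ w≢x → w≢x ∘ sym) (deeper-∉ shallow dw)) ,
      ≤-reflexive du ∷ ∷ʳ⁺ (All.map m≤n⇒m≤1+n shallow) (≤-reflexive dw) ,
      s≤s (subst (2 ≤_) (sym (length-++ xs)) (+-monoˡ-≤ 1 (Path-nonempty path)))

  module _ (acyclic : AcyclicU D) where

    adjacent-depths-differ : ∀ {u w} → UAdj D u w → depth u ≢ depth w
    adjacent-depths-differ {u} {w} u~w du≡dw with u ≟ w
    ... | yes refl = ¬UAdj-refl D u~w
    ... | no  u≢w  with long-path-below (depth u) {u} {w} refl (sym du≡dw) u≢w
    ... | xs , path , unique , _ , long = acyclic xs (closed-path⇒cycle path unique long (UAdj-sym D u~w))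

    lower-neighbour-unique : ∀ {u w v} → UAdj D u v → UAdj D w v →
                             depth u < depth v → depth w < depth v → u ≡ w
    lower-neighbour-unique {u} {w} {v} u~v w~v u<v w<v with u ≟ w
    ... | yes u≡w = u≡w
    ... | no  u≢w with long-path-below (depth u) {u} {w} refl (sym du≡dw) u≢w
      where
      du≡dw : depth u ≡ depth w
      du≡dw = suc-injective (trans (sym (depth-lower-adj u~v u<v)) (depth-lower-adj w~v w<v))
    ... | xs , path , unique , shallow , long =
      ⊥-elim (acyclic (v ∷ xs) (closed-path⇒cycle (UAdj-sym D u~v ◅ path)
                (deeper-∉ shallow (depth-lower-adj u~v u<v) ∷ unique) (m≤n⇒m≤1+n long) w~v))

module Greedy (D : Digraph) (level : Fin (size D) → ℕ)
  (level-adj : ∀ {u w} → UAdj D u w → level u ≢ level w)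
  (lower-unique : ∀ {u w v} → UAdj D u v → UAdj D w v → level u < level v → level w < level v → u ≡ w)
  (in-nbr : ∀ v → ∃ λ u → Arc D u v)
  where

  lower-in-nbr : ∀ v → ∃ λ x → Arc D x v × (∀ {c} → Arc D c v → level c < level v → c ≡ x)
  lower-in-nbr v with any? (λ c → (arc D c v Bool.≟ true) ×-dec (level c <? level v))
  ... | yes (x , x→v , x<v) = x , x→v , λ c→v c<v → lower-unique (arc⇒UAdj D c→v) (arc⇒UAdj D x→v) c<v x<v
  ... | no  none            = proj₁ (in-nbr v) , proj₂ (in-nbr v) , λ c→v c<v → contradiction (_ , c→v , c<v) none

  no-common-in-nbr : ∀ {Rem : Subset (size D)} {v x w c} → (∀ {y} → y ∈ Rem → level y ≤ level v) →
                     Arc D x v → (∀ {c} → Arc D c v → level c < level v → c ≡ x) →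
                     w ∈ Rem → ¬ Arc D x w → Arc D c v → Arc D c w → ⊥
  no-common-in-nbr {v = v} {x} {w} {c} deepest x→v lower w∈Rem x↛w c→v c→w with <-cmp (level c) (level v)
  ... | tri< c<v _ _ = x↛w (subst (λ c → Arc D c w) (lower c→v c<v) c→w)
  ... | tri≈ _ c≡v _ = level-adj (arc⇒UAdj D c→v) c≡v
  ... | tri> _ _ v<c with <-cmp (level w) (level c)
  ...   | tri< w<c _ _ = x↛w (subst (Arc D x) (sym w≡v) x→v)
    where
    w≡v : w ≡ v
    w≡v = lower-unique (UAdj-sym D (arc⇒UAdj D c→w)) (UAdj-sym D (arc⇒UAdj D c→v)) w<c v<c
  ...   | tri≈ _ w≡c _ = level-adj (arc⇒UAdj D c→w) (sym w≡c)
  ...   | tri> _ _ c<w = <-irrefl refl (<-≤-trans (<-trans v<c c<w) (deepest w∈Rem))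

  record Invariant (Rem P S : Subset (size D)) : Set where
    field
      dominated : ∀ {v} → v ∉ Rem → ∃ λ s → s ∈ S × Arc D s v
      packing   : OpenPacking D P
      separated : ∀ {p v c} → p ∈ P → v ∈ Rem → Arc D c p → Arc D c v → ⊥
      ∣S∣≤∣P∣   : ∣ S ∣ ≤ ∣ P ∣

  module Step {Rem P S} (inv : Invariant Rem P S) {v x} (v∈Rem : v ∈ Rem)
    (deepest : ∀ {y} → y ∈ Rem → level y ≤ level v) (x→v : Arc D x v)
    (lower : ∀ {c} → Arc D c v → level c < level v → c ≡ x) where

    open Invariant inv

    Rem′ P′ S′ : Subset (size D)
    Rem′ = Rem ─ outNbrs D x
    P′   = P ∪ ⁅ v ⁆
    S′   = S ∪ ⁅ x ⁆

    shrinks : ∣ Rem′ ∣ < ∣ Rem ∣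
    shrinks = p∩q≢∅⇒∣p─q∣<∣p∣ Rem (outNbrs D x) (v , x∈p∩q⁺ (v∈Rem , ∈-tabulate⁺ x→v))

    v∉P : v ∉ P
    v∉P v∈P = separated v∈P v∈Rem x→v x→v

    ∈P′⁻ : ∀ {p} → p ∈ P′ → p ∈ P ⊎ p ≡ v
    ∈P′⁻ p∈P′ = Sum.map₂ (x∈⁅y⁆⇒x≡y v) (x∈p∪q⁻ P ⁅ v ⁆ p∈P′)

    dominated′ : ∀ {y} → y ∉ Rem′ → ∃ λ s → s ∈ S′ × Arc D s y
    dominated′ {y} y∉Rem′ with y ∈? outNbrs D x
    ... | yes y∈out = x , q⊆p∪q S ⁅ x ⁆ (x∈⁅x⁆ x) , ∈-tabulate⁻ y∈out
    ... | no  y∉out with dominated (λ y∈Rem → y∉Rem′ (x∈p∧x∉q⇒x∈p─q y∈Rem y∉out))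
    ...   | s , s∈S , s→y = s , p⊆p∪q ⁅ x ⁆ s∈S , s→y

    separated′ : ∀ {p y c} → p ∈ P′ → y ∈ Rem′ → Arc D c p → Arc D c y → ⊥
    separated′ p∈P′ y∈Rem′ c→p c→y with ∈P′⁻ p∈P′
    ... | inj₁ p∈P  = separated p∈P (p─q⊆p Rem _ y∈Rem′) c→p c→y
    ... | inj₂ refl = no-common-in-nbr deepest x→v lower (p─q⊆p Rem _ y∈Rem′)
                        (λ x→y → x∈p─q⇒x∉q Rem _ y∈Rem′ (∈-tabulate⁺ x→y)) c→p c→y

    packing′ : OpenPacking D P′
    packing′ p∈P′ q∈P′ c→p c→q with ∈P′⁻ p∈P′ | ∈P′⁻ q∈P′
    ... | inj₁ p∈P  | inj₁ q∈P  = packing p∈P q∈P c→p c→q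
    ... | inj₁ p∈P  | inj₂ refl = ⊥-elim (separated p∈P v∈Rem c→p c→q)
    ... | inj₂ refl | inj₁ q∈P  = ⊥-elim (separated q∈P v∈Rem c→q c→p)
    ... | inj₂ refl | inj₂ refl = refl

    ∣S′∣≤∣P′∣ : ∣ S′ ∣ ≤ ∣ P′ ∣
    ∣S′∣≤∣P′∣ = begin
      ∣ S ∪ ⁅ x ⁆ ∣      ≤⟨ ∣p∪q∣≤∣p∣+∣q∣ S ⁅ x ⁆ ⟩
      ∣ S ∣ + ∣ ⁅ x ⁆ ∣  ≡⟨ cong (∣ S ∣ +_) (∣⁅x⁆∣≡1 x) ⟩
      ∣ S ∣ + 1          ≤⟨ +-monoˡ-≤ 1 ∣S∣≤∣P∣ ⟩
      ∣ P ∣ + 1          ≡⟨ +-comm ∣ P ∣ 1 ⟩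
      suc ∣ P ∣          ≤⟨ p⊂q⇒∣p∣<∣q∣ (p⊆p∪q ⁅ v ⁆ , v , q⊆p∪q P ⁅ v ⁆ (x∈⁅x⁆ v) , v∉P) ⟩
      ∣ P ∪ ⁅ v ⁆ ∣      ∎
      where open ≤-Reasoning

    invariant : Invariant Rem′ P′ S′
    invariant = record
      { dominated = dominated′ ; packing = packing′ ; separated = separated′ ; ∣S∣≤∣P∣ = ∣S′∣≤∣P′∣ }

  PackingOverTDS : Set
  PackingOverTDS = ∃₂ λ P S → OpenPacking D P × IsTDS D S × ∣ S ∣ ≤ ∣ P ∣

  greedy : ∀ fuel {Rem P S} → ∣ Rem ∣ < fuel → Invariant Rem P S → PackingOverTDS
  greedy (suc fuel) {Rem} {P} {S} bound inv with nonempty? Rem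
  ... | no  empty = P , S , packing , (λ v → dominated λ v∈ → empty (v , v∈)) , ∣S∣≤∣P∣
    where open Invariant inv
  ... | yes (_ , v₀∈Rem) with argmax-∈ level v₀∈Rem
  ... | v , v∈Rem , deepest with lower-in-nbr v
  ... | x , x→v , lower = greedy fuel (<-≤-trans shrinks (s≤s⁻¹ bound)) invariant
    where open Step inv v∈Rem deepest x→v lower

  packing-over-TDS : PackingOverTDS
  packing-over-TDS = greedy (suc (size D)) {⊤} {∅} {∅} (s≤s (∣p∣≤n ⊤)) record
    { dominated = λ v∉⊤ → contradiction ∈⊤ v∉⊤
    ; packing   = λ p∈∅ → contradiction p∈∅ ∉⊥
    ; separated = λ p∈∅ → contradiction p∈∅ ∉⊥
    ; ∣S∣≤∣P∣   = ≤-refl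
    }

corollary5p3 : (T H : Digraph) → IsDitree T → MinInDegGe1 T → MinInDegGe1 H →
    (a b : ℕ) → IsGammaT T a → IsGammaT H b → IsGammaT (T ×ᴰ H) (a * b)
corollary5p3 T H (nonempty , connected , acyclic) δ⁻T≥1 _ a b
             ((S , S-tds , ∣S∣≡a) , γₜT-min) ((R , R-tds , ∣R∣≡b) , γₜH-min) =
  (S ⊠ R , IsTDS-⊠ T H S-tds R-tds , trans (∣⊠∣ S R) (cong₂ _*_ ∣S∣≡a ∣R∣≡b)) , γₜ-lower-bound
  where
  open Depth T (fromℕ< nonempty) connected
  open Greedy T depth (adjacent-depths-differ acyclic) (lower-neighbour-unique acyclic)
                      (in-neighbour T δ⁻T≥1)

  γₜ-lower-bound : ∀ D → IsTDS (T ×ᴰ H) D → a * b ≤ ∣ D ∣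
  γₜ-lower-bound D D-tds with packing-over-TDS
  ... | P , S′ , packing , S′-tds , ∣S′∣≤∣P∣ =
    ≤-trans (*-monoˡ-≤ b (≤-trans (γₜT-min S′ S′-tds) ∣S′∣≤∣P∣)) (packing-bound T H packing γₜH-min D-tds)
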